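{- Let $G=(V,E)$ be a connected graph with $n\ge 2$ vertices, $b$ an integer with $1\le b<n$, and $\mathcal{D}$ a fixed rooted spanning tree of $G$. There is a constant $\kappa<4.83$ such that the total number of states visited by the second phase, summed over all segment assignments generated by the first phase, is at most $3(n+1)\kappa^n$.
   Context: For integers $i<j$, the segment $\Theta_{(i,j)}$ is $\{i(b+1)+1,\dots,j(b+1)\}\cap\{1,\dots,n\}$, considered only when nonempty; $\Theta_i:=\Theta_{(i,i+1)}$ are base segments. For a position $p$, $\mathtt{segment}(p)=\lceil p/(b+1)\rceil$, $\mathtt{color}(p)=((p-1)\bmod(b+1))+1$; the color order sorts positions $1,\dots,n$ lexicographically by $(\mathtt{color}(p),\mathtt{segment}(p))$. In $\mathcal{D}$, a leaf is a non-root vertex with no children; other vertices (including the root) are inner. A segment assignment is a function $\phi$ assigning a segment to every vertex such that: (1) every leaf gets a segment $\Theta_{(i,i+4)}$; (2) every inner vertex gets a segment $\Theta_{(i,i+2)}$; (3) if $u$ is the parent of an inner vertex $v$ in $\mathcal{D}$, $\phi(u)=\Theta_{(i,i+2)}$, $\phi(v)=\Theta_{(j,j+2)}$, then $|i-j|=1$; (4) if $v$ is a leaf with parent $u$ and $\phi(u)=\Theta_{(i,i+2)}$, then $\phi(v)=\Theta_{(i-1,i+3)}$. First phase: the root is assigned any (nonempty) segment $\Theta_{(i,i+2)}$; then, in root-to-leaf order, a vertex $u$ whose parent got $\Theta_{(i,i+2)}$ is assigned $\Theta_{(i-1,i+1)}$ or $\Theta_{(i+1,i+3)}$ (in all possible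 ways) if $u$ is inner, and $\Theta_{(i-1,i+3)}$ if $u$ is a leaf; among the resulting segment assignments, exactly those are generated for which every edge $uv\in E$ with $\phi(u)=\Theta_{(i,j)}$, $\phi(v)=\Theta_{(k,l)}$ satisfies $j\ge k$ and $l\ge i$. For a fixed $\phi$: a state candidate is a partial function $s$ from $V$ to $\{\Theta_i: 0\le i<\lceil n/(b+1)\rceil\}$ with $s(v)\subseteq\phi(v)$ whenever defined. A state is a state candidate $s$ such that: (1) the vertices of $\mathrm{dom}(s)$ can be bijectively assigned to the first $|\mathrm{dom}(s)|$ positions in the color order so that each $v$ gets a position in $s(v)$; (2) for every edge $uv\in E$: either both $s(u),s(v)$ are undefined; or exactly one is defined, say $s(v)=\Theta_i$ and $s(u)$ undefined, and then, writing $\phi(u)=\Theta_{(k,l)}$, we have $k\le i$; or both are defined, $s(v)=\Theta_i$, $s(u)=\Theta_k$, and $|i-k|\le1$. A state $s'$ is an extension of a state $s$ if there is a vertex $v$ with $s(v)$ undefined, $\mathrm{dom}(s')=\mathrm{dom}(s)\cup\{v\}$, $s'$ agrees with $s$ on $\mathrm{dom}(s)$, and for every edge $uv\in E$ with $s'(u)=\Theta_k$, $s'(v)=\Theta_i$ we have $k-1\le i\le k$. The second phase on $\phi$ is a depth-first search over states (each visited at most once) starting from the empty state; from a state $s$ with $|\mathrm{dom}(s)|=k<n$ it moves to every extension $s'$ of $s$ obtained by defining $s'$ at some vertex undefined in $s$ as the base segment containing the $(k+1)$-th position in the color order; it stops when a state with domain $V$ is reached or the search is exhausted. -}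

module Defs where

open import Data.Nat as ℕ using (ℕ; zero; suc; _≤_; _<_; _∸_; _/_; _%_)
open import Data.Integer as ℤ using (ℤ; +_)
open import Data.Fin using (Fin)
open import Data.Maybe using (Maybe; just; nothing)
open import Data.Product using (Σ; ∃; ∃-syntax; _×_; _,_; proj₁; proj₂)
open import Data.Sum using (_⊎_)
open import Data.Unit using (⊤)
open import Data.List as List using (List; []; _∷_; concatMap; applyUpTo; filter; take; length)
open import Data.List.Membership.Propositional using (_∈_)
open import Data.List.Relation.Unary.Unique.Propositional using (Unique)
open import Data.List.Relation.Unary.All using (All)
open import Data.Vec as Vec using (Vec; lookup; replicate; _[_]≔_)
open import Relation.Binary.PropositionalEquality using (_≡_; _≢_)
open import Relation.Nullary using (¬_)

record Graph (n : ℕ) : Set₁ where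
  field
    E     : Fin n → Fin n → Set
    sym   : ∀ {u v} → E u v → E v u
    irrefl : ∀ {v} → ¬ E v v

data Path {n : ℕ} (G : Graph n) : Fin n → Fin n → Set where
  here : ∀ {v} → Path G v v
  step : ∀ {u w v} → Graph.E G u w → Path G w v → Path G u v

Connected : ∀ {n} → Graph n → Set
Connected {n} G = (u v : Fin n) → Path G u v

-- Every non-root
-- vertex has exactly one parent, parent edges are edges of G, and the
-- parent relation is acyclic (witnessed by a strictly decreasing height).
record RootedSpanningTree {n : ℕ} (G : Graph n) : Set where
  field
    root        : Fin n
    parent      : Fin n → Maybe (Fin n)
    parent-root : parent root ≡ nothing
    has-parent  : ∀ v → v ≢ root → ∃[ u ] (parent v ≡ just u)
    parent-edge : ∀ {u v} → parent v ≡ just u → Graph.E G u v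
    height      : Fin n → ℕ
    height-dec  : ∀ {u v} → parent v ≡ just u → height u < height v

module _ {n : ℕ} {G : Graph n} (D : RootedSpanningTree G) where
  open RootedSpanningTree D

  IsLeaf : Fin n → Set
  IsLeaf v = (v ≢ root) × (∀ w → parent w ≢ just v)

-- Segments.  Positions are natural numbers 1..n.
-- Θ_(i,j) = {i(b+1)+1, …, j(b+1)} ∩ {1,…,n}, for integers i, j.

InSeg : (n b : ℕ) → ℤ × ℤ → ℕ → Set
InSeg n b (i , j) p =
  (1 ≤ p) × (p ≤ n) ×
  (i ℤ.* + (suc b) ℤ.+ + 1 ℤ.≤ + p) × (+ p ℤ.≤ j ℤ.* + (suc b))

NonEmptySeg : (n b : ℕ) → ℤ × ℤ → Set
NonEmptySeg n b ij = ∃[ p ] InSeg n b ij p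

baseSeg : ℕ → ℤ × ℤ
baseSeg i = (+ i , + suc i)

-- ⌈ n / (b+1) ⌉ : number of base segments
numSeg : (n b : ℕ) → ℕ
numSeg n b = (n ℕ.+ b) / suc b

-- segment(p) = ⌈ p/(b+1) ⌉ ,  color(p) = ((p-1) mod (b+1)) + 1
segmentOf : (b p : ℕ) → ℕ
segmentOf b p = (p ℕ.+ b) / suc b

colorOf : (b p : ℕ) → ℕ
colorOf b p = suc ((p ∸ 1) % suc b)

baseIdx : (b p : ℕ) → ℕ
baseIdx b p = segmentOf b p ∸ 1

-- The color order: positions 1..n listed lexicographically by
-- (color, segment).  The position with color c and segment s is
-- (s-1)(b+1)+c.
colorOrder : (n b : ℕ) → List ℕ
colorOrder n b =
  concatMap (λ c → filter (λ p → p ℕ.≤? n)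
                     (applyUpTo (λ s → s ℕ.* suc b ℕ.+ suc c) (numSeg n b)))
            (applyUpTo (λ c → c) (suc b))

at : List ℕ → ℕ → Maybe ℕ
at []       _       = nothing
at (x ∷ xs) zero    = just x
at (x ∷ xs) (suc k) = at xs k

-- Segment assignments, recorded by their index pairs (i , j) for Θ_(i,j).

Assignment : ℕ → Set
Assignment n = Vec (ℤ × ℤ) n

module _ {n : ℕ} (b : ℕ) (G : Graph n) (D : RootedSpanningTree G) where
  open RootedSpanningTree D
  open Graph G

  record Generated (φ : Assignment n) : Set where
    field
      nonempty : ∀ v → NonEmptySeg n b (lookup φ v)
      inner    : ∀ v → ¬ IsLeaf D v →
                   ∃[ i ] (lookup φ v ≡ (i , i ℤ.+ + 2))
      leaf     : ∀ v u → parent v ≡ just u → IsLeaf D v →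
                   lookup φ v ≡ (proj₁ (lookup φ u) ℤ.- + 1 , proj₁ (lookup φ u) ℤ.+ + 3)
      inner-child : ∀ v u → parent v ≡ just u → ¬ IsLeaf D v →
                   (proj₁ (lookup φ v) ≡ proj₁ (lookup φ u) ℤ.- + 1)
                   ⊎ (proj₁ (lookup φ v) ≡ proj₁ (lookup φ u) ℤ.+ + 1)
      edge-ok  : ∀ u v → E u v →
                   (proj₁ (lookup φ v) ℤ.≤ proj₂ (lookup φ u))
                   × (proj₁ (lookup φ u) ℤ.≤ proj₂ (lookup φ v))

  -- States (for a fixed φ).  A partial function V → base segments is a
  -- vector of Maybe ℕ (just i means s(v) = Θ_i).

  PState : Set
  PState = Vec (Maybe ℕ) n

  domSize : ∀ {m} → Vec (Maybe ℕ) m → ℕ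
  domSize Vec.[]             = 0
  domSize (nothing Vec.∷ xs) = domSize xs
  domSize (just _ Vec.∷ xs)  = suc (domSize xs)

  -- condition (2) for an ordered edge (u,v); k = lower index of φ(u)
  EdgeOK : ℤ → Maybe ℕ → Maybe ℕ → Set
  EdgeOK k nothing  nothing  = ⊤
  EdgeOK k nothing  (just i) = k ℤ.≤ + i
  EdgeOK k (just _) nothing  = ⊤
  EdgeOK k (just a) (just c) = (a ≤ suc c) × (c ≤ suc a)

  record IsState (φ : Assignment n) (s : PState) : Set where
    field
      range    : ∀ v i → lookup s v ≡ just i → i < numSeg n b
      subset   : ∀ v i → lookup s v ≡ just i →
                   ∀ p → InSeg n b (baseSeg i) p → InSeg n b (lookup φ v) p
      pos      : Fin n → ℕ
      pos-ok   : ∀ v i → lookup s v ≡ just i →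
                   (pos v ∈ take (domSize s) (colorOrder n b))
                   × InSeg n b (baseSeg i) (pos v)
      pos-inj  : ∀ v w i j → lookup s v ≡ just i → lookup s w ≡ just j →
                   pos v ≡ pos w → v ≡ w
      pos-surj : ∀ p → p ∈ take (domSize s) (colorOrder n b) →
                   ∃[ v ] ∃[ i ] ((lookup s v ≡ just i) × (pos v ≡ p))
      -- (2) edge condition (E is symmetric, so all orientations are covered)
      edges    : ∀ u v → E u v →
                   EdgeOK (proj₁ (lookup φ u)) (lookup s u) (lookup s v)

  emptyState : PState
  emptyState = replicate n nothing

  record Move (φ : Assignment n) (s s' : PState) : Set where
    field
      v        : Fin n
      undef    : lookup s v ≡ nothing
      p        : ℕ
      p-at     : at (colorOrder n b) (domSize s) ≡ just p
      s'-def   : s' ≡ s [ v ]≔ just (baseIdx b p)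
      s'-state : IsState φ s'
      ext      : ∀ u k → E u v → lookup s' u ≡ just k →
                   (k ≤ suc (baseIdx b p)) × (baseIdx b p ≤ k)

  data Visited (φ : Assignment n) : PState → Set where
    start : Visited φ emptyState
    move  : ∀ {s s'} → Visited φ s → Move φ s s' → Visited φ s'

  GenVisited : Assignment n × PState → Set
  GenVisited (φ , s) = Generated φ × Visited φ s

module Submission where

-- Record a generated segment assignment φ and a state s visited on it as the labelling of the
-- tree D that gives each vertex v the item (φ(v), s(v)).  Along a tree edge the parent's item
-- leaves its child only a few items: φ of the child is one of two segments (of one, for a leaf),
-- s of the child is undefined or a base segment inside it, and the edge condition of a state
-- forbids some of these according to whether s of the parent is undefined or its lower or upper
-- base segment.  Distinct pairs (φ, s) give distinct labellings, which are counted by a potential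
-- argument: label D from the root downwards and give a labelled vertex weight 35 and an unlabelled
-- one a budget depending on its parent's item (169 while the parent is unlabelled, 3(n+1) · 169
-- at the root).  With budgets 140 for a leaf and 128 or 169 for an inner vertex, labelling one
-- more vertex in all possible ways does not increase the total potential; complete labellings
-- weigh 35^n and the empty labelling 3(n+1) · 169^n, so κ = 169/35 < 4.83.

open import Defs
open import Data.Nat using (ℕ)
open import Data.Fin using (Fin)
open import Data.List using (List)

module BigOperators where
  open import Data.Nat using (zero; suc; _≤_; _<_; _*_; _+_; _^_; _⊔_; z≤n; s≤s)
  import Data.Nat.Properties as ℕP
  open import Data.Nat.ListAction using (sum)
  open import Data.Nat.ListAction.Properties using (sum-++)
  open import Algebra.Properties.CommutativeSemigroup ℕP.*-commutativeSemigroup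
    using (interchange; x∙yz≈y∙xz; xy∙z≈x∙zy)
  open import Data.Fin using (zero; suc)
  open import Data.Vec using (Vec; lookup)
  open import Data.Vec.Properties using (tabulate∘lookup; tabulate-cong)
  open import Data.Vec.Functional using (updateAt)
  open import Data.List using ([]; _∷_; _++_; length; map; concatMap)
  open import Data.List.Properties using (map-++; length-removeAt′)
  open import Data.List.Relation.Unary.All using (All; []; _∷_)
  open import Data.List.Relation.Unary.Any using (here; there; index; _─_)
  open import Data.List.Membership.Propositional using (_∈_)
  open import Data.List.Relation.Unary.Unique.Propositional using (Unique; _∷_)
  open import Data.Product using (∃-syntax; _,_)
  open import Data.Empty using (⊥-elim)
  open import Function using (_∘_; const)
  open import Relation.Binary.PropositionalEquality

  ∏ : ∀ {n} → (Fin n → ℕ) → ℕ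
  ∏ {zero}  f = 1
  ∏ {suc n} f = f zero * ∏ (f ∘ suc)

  ∏-cong : ∀ {n} {f g : Fin n → ℕ} → (∀ c → f c ≡ g c) → ∏ f ≡ ∏ g
  ∏-cong {zero}  f≗g = refl
  ∏-cong {suc n} f≗g = cong₂ _*_ (f≗g zero) (∏-cong (f≗g ∘ suc))

  ∏-mono-≤ : ∀ {n} {f g : Fin n → ℕ} → (∀ c → f c ≤ g c) → ∏ f ≤ ∏ g
  ∏-mono-≤ {zero}  f≤g = ℕP.≤-refl
  ∏-mono-≤ {suc n} f≤g = ℕP.*-mono-≤ (f≤g zero) (∏-mono-≤ (f≤g ∘ suc))

  ∏-const : ∀ {n} k → ∏ {n} (const k) ≡ k ^ n
  ∏-const {zero}  k = refl
  ∏-const {suc n} k = cong (k *_) (∏-const {n} k)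

  ∏-distrib-* : ∀ {n} (f g : Fin n → ℕ) → ∏ (λ c → f c * g c) ≡ ∏ f * ∏ g
  ∏-distrib-* {zero}  f g = refl
  ∏-distrib-* {suc n} f g =
    trans (cong (f zero * g zero *_) (∏-distrib-* (f ∘ suc) (g ∘ suc)))
          (interchange (f zero) (g zero) (∏ (f ∘ suc)) (∏ (g ∘ suc)))

  ∏-mono-≤-at : ∀ {n} {f g : Fin n → ℕ} A B → (∀ c → f c ≤ g c) →
                ∀ c → A * f c ≤ B * g c → A * ∏ f ≤ B * ∏ g
  ∏-mono-≤-at {suc n} {f} {g} A B f≤g zero Af≤Bg = begin
    A * (f zero * ∏ (f ∘ suc))  ≡⟨ ℕP.*-assoc A _ _ ⟨
    A * f zero * ∏ (f ∘ suc)    ≤⟨ ℕP.*-mono-≤ Af≤Bg (∏-mono-≤ (f≤g ∘ suc)) ⟩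
    B * g zero * ∏ (g ∘ suc)    ≡⟨ ℕP.*-assoc B _ _ ⟩
    B * (g zero * ∏ (g ∘ suc))  ∎
    where open ℕP.≤-Reasoning
  ∏-mono-≤-at {suc n} {f} {g} A B f≤g (suc c) Af≤Bg = begin
    A * (f zero * ∏ (f ∘ suc))  ≡⟨ x∙yz≈y∙xz A (f zero) _ ⟩
    f zero * (A * ∏ (f ∘ suc))  ≤⟨ ℕP.*-mono-≤ (f≤g zero) (∏-mono-≤-at A B (f≤g ∘ suc) c Af≤Bg) ⟩
    g zero * (B * ∏ (g ∘ suc))  ≡⟨ x∙yz≈y∙xz (g zero) B _ ⟩
    B * (g zero * ∏ (g ∘ suc))  ∎
    where open ℕP.≤-Reasoning

  ∏-updateAt : ∀ {n} (f : Fin n → ℕ) v A → ∏ (updateAt f v (const A)) * f v ≡ A * ∏ f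
  ∏-updateAt {suc n} f zero    A = xy∙z≈x∙zy A (∏ (f ∘ suc)) (f zero)
  ∏-updateAt {suc n} f (suc v) A = begin
    f zero * ∏ (updateAt (f ∘ suc) v (const A)) * f (suc v)  ≡⟨ ℕP.*-assoc (f zero) _ _ ⟩
    f zero * (∏ (updateAt (f ∘ suc) v (const A)) * f (suc v)) ≡⟨ cong (f zero *_) (∏-updateAt (f ∘ suc) v A) ⟩
    f zero * (A * ∏ (f ∘ suc))                                 ≡⟨ x∙yz≈y∙xz (f zero) A _ ⟩
    A * (f zero * ∏ (f ∘ suc))                                 ∎
    where open ≡-Reasoning

  bounded : ∀ {n} (f : Fin n → ℕ) → ∃[ T ] (∀ c → f c < T)
  bounded {zero}  f = 0 , λ ()
  bounded {suc n} f with bounded (f ∘ suc)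
  ... | T , f<T = suc (f zero) ⊔ T , λ
    { zero    → ℕP.m≤m⊔n (suc (f zero)) T
    ; (suc c) → ℕP.<-≤-trans (f<T c) (ℕP.m≤n⊔m (suc (f zero)) T) }

  lookup-extensionality : ∀ {A : Set} {n} (xs ys : Vec A n) → (∀ i → lookup xs i ≡ lookup ys i) → xs ≡ ys
  lookup-extensionality xs ys eq =
    trans (sym (tabulate∘lookup xs)) (trans (tabulate-cong eq) (tabulate∘lookup ys))

  sum-map-*ʳ : ∀ {A : Set} (f : A → ℕ) k xs → sum (map (λ x → f x * k) xs) ≡ sum (map f xs) * k
  sum-map-*ʳ f k []       = refl
  sum-map-*ʳ f k (x ∷ xs) =
    trans (cong ((f x * k) +_) (sum-map-*ʳ f k xs)) (sym (ℕP.*-distribʳ-+ k (f x) _))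

  sum-map-concatMap : ∀ {A B : Set} (f : B → ℕ) (g : A → List B) xs →
                      sum (map f (concatMap g xs)) ≡ sum (map (λ x → sum (map f (g x))) xs)
  sum-map-concatMap f g []       = refl
  sum-map-concatMap f g (x ∷ xs) = begin
    sum (map f (g x ++ concatMap g xs))
      ≡⟨ cong sum (map-++ f (g x) _) ⟩
    sum (map f (g x) ++ map f (concatMap g xs))
      ≡⟨ sum-++ (map f (g x)) _ ⟩
    sum (map f (g x)) + sum (map f (concatMap g xs))
      ≡⟨ cong (sum (map f (g x)) +_) (sum-map-concatMap f g xs) ⟩
    sum (map f (g x)) + sum (map (λ x → sum (map f (g x))) xs) ∎
    where open ≡-Reasoning

  sum-map-mono-≤ : ∀ {A : Set} {P : A → Set} {f g : A → ℕ} {xs} →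
                   (∀ {x} → P x → f x ≤ g x) → All P xs → sum (map f xs) ≤ sum (map g xs)
  sum-map-mono-≤ f≤g []         = z≤n
  sum-map-mono-≤ f≤g (px ∷ pxs) = ℕP.+-mono-≤ (f≤g px) (sum-map-mono-≤ f≤g pxs)

  sum-map-const : ∀ {A : Set} {f : A → ℕ} {k xs} → All (λ x → f x ≡ k) xs → sum (map f xs) ≡ length xs * k
  sum-map-const []         = refl
  sum-map-const (fx≡k ∷ ps) = cong₂ _+_ fx≡k (sum-map-const ps)

  sum-map-≤ : ∀ {A : Set} {f : A → ℕ} {k} xs → (∀ x → f x ≤ k) → sum (map f xs) ≤ length xs * k
  sum-map-≤ []       f≤k = z≤n
  sum-map-≤ (x ∷ xs) f≤k = ℕP.+-mono-≤ (f≤k x) (sum-map-≤ xs f≤k)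

  ∈-─ : ∀ {A : Set} {x z : A} {ys} (x∈ys : x ∈ ys) → z ∈ ys → z ≢ x → z ∈ (ys ─ x∈ys)
  ∈-─ (here refl)  (here refl)  z≢x = ⊥-elim (z≢x refl)
  ∈-─ (here refl)  (there z∈ys) z≢x = z∈ys
  ∈-─ (there x∈ys) (here refl)  z≢x = here refl
  ∈-─ (there x∈ys) (there z∈ys) z≢x = there (∈-─ x∈ys z∈ys z≢x)

  unique-⊆⇒length≤ : ∀ {A : Set} {xs ys : List A} → Unique xs → (∀ {z} → z ∈ xs → z ∈ ys) →
                     length xs ≤ length ys
  unique-⊆⇒length≤ {xs = []}     _             _     = z≤n
  unique-⊆⇒length≤ {xs = x ∷ xs} {ys} (x∉xs ∷ xs!) xs⊆ys =
    subst (suc (length xs) ≤_) (sym (length-removeAt′ ys (index x∈ys)))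
      (s≤s (unique-⊆⇒length≤ xs! λ z∈xs → ∈-─ x∈ys (xs⊆ys (there z∈xs)) (≢-from-All x∉xs z∈xs)))
    where
    x∈ys : x ∈ ys
    x∈ys = xs⊆ys (here refl)
    ≢-from-All : ∀ {zs z} → All (x ≢_) zs → z ∈ zs → z ≢ x
    ≢-from-All (x≢z ∷ _)  (here refl) z≡x = x≢z (sym z≡x)
    ≢-from-All (_ ∷ x≢zs) (there z∈zs)    = ≢-from-All x≢zs z∈zs


module TreeLabellings
  {n : ℕ} {G : Graph n} (D : RootedSpanningTree G) {Item : Set}
  (unit free : ℕ)
  (rootCands : List Item) (rootBudget : ℕ)
  (childCands : Fin n → Item → List Item) (budget : Fin n → Item → ℕ)
  where

  open import Data.Nat using (zero; suc; _≤_; _<_; _*_; _+_; _^_; z≤n; _<?_; _≟_)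
  import Data.Nat.Properties as ℕP
  open import Data.Nat.ListAction using (sum)
  open import Data.Bool using (Bool; true; false; if_then_else_)
  open import Data.Fin as F using (toℕ)
  import Data.Fin.Properties as FP
  open import Data.Maybe using (Maybe; just; nothing; maybe′)
  open import Data.Maybe.Properties using (just-injective) renaming (≡-dec to ≡-dec-Maybe)
  open import Data.Vec as V using (Vec; lookup; replicate; tabulate; _[_]≔_)
  open import Data.Vec.Properties using (lookup∘update; lookup∘update′; lookup-replicate; lookup∘tabulate; lookup-map)
  open import Data.Vec.Functional using (updateAt)
  open import Data.Vec.Functional.Properties using (updateAt-updates; updateAt-minimal)
  open import Data.List using ([]; _∷_; length; map; concatMap)
  import Data.List.Properties as LP
  open import Data.List.Membership.Propositional using (_∈_)
  open import Data.List.Membership.Propositional.Properties using (∈-map⁺; ∈-map⁻; ∈-concatMap⁺)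
  open import Data.List.Relation.Unary.All as All using (All; []; _∷_)
  open import Data.List.Relation.Unary.All.Properties using (map⁺; concat⁺)
  open import Data.List.Relation.Unary.Any as Any using (here)
  open import Data.List.Relation.Unary.Unique.Propositional using (Unique)
  import Data.List.Relation.Unary.Unique.Propositional.Properties as Unique
  open import Data.Product using (∃; _×_; _,_; proj₁; proj₂)
  open import Data.Empty using (⊥-elim)
  open import Function using (_∘_; const)
  open import Relation.Nullary using (¬_; Dec; yes; no; does)
  open import Relation.Nullary.Decidable using (dec-true; dec-false)
  open import Relation.Binary.Definitions using (DecidableEquality; tri<; tri≈; tri>)
  open import Relation.Binary.PropositionalEquality
  open BigOperators


  open RootedSpanningTree D

  Labelling : Set
  Labelling = Vec (Maybe Item) n

  unlabelled : Labelling
  unlabelled = replicate n nothing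

  waiting : Fin n → Maybe (Fin n) → Labelling → ℕ
  waiting c nothing  σ = rootBudget
  waiting c (just u) σ = maybe′ (budget c) free (lookup σ u)

  weight : Labelling → Fin n → ℕ
  weight σ c = maybe′ (const unit) (waiting c (parent c) σ) (lookup σ c)

  potential : Labelling → ℕ
  potential σ = ∏ (weight σ)

  candidates : Fin n → Maybe (Fin n) → Labelling → List Item
  candidates v nothing  σ = rootCands
  candidates v (just u) σ = maybe′ (childCands v) [] (lookup σ u)

  extensions : Fin n → Labelling → List Labelling
  extensions v σ = map (λ x → σ [ v ]≔ just x) (candidates v (parent v) σ)

  _≟ₚ_ : DecidableEquality (Maybe (Fin n))
  _≟ₚ_ = ≡-dec-Maybe F._≟_

  isChildOf : Fin n → Fin n → Bool
  isChildOf v c = does (parent c ≟ₚ just v)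

  onChildren : Fin n → (Fin n → ℕ) → (Fin n → ℕ) → Fin n → ℕ
  onChildren v g h c = if isChildOf v c then g c else h c

  onChildren-child : ∀ {v c} g h → parent c ≡ just v → onChildren v g h c ≡ g c
  onChildren-child {v} {c} g h pc≡v = cong (λ b → if b then g c else h c) (dec-true (parent c ≟ₚ just v) pc≡v)

  onChildren-other : ∀ {v c} g h → parent c ≢ just v → onChildren v g h c ≡ h c
  onChildren-other {v} {c} g h pc≢v = cong (λ b → if b then g c else h c) (dec-false (parent c ≟ₚ just v) pc≢v)

  ∏children : Fin n → (Fin n → ℕ) → ℕ
  ∏children v g = ∏ (onChildren v g (const 1))

  childrenBudget : Fin n → Item → ℕ
  childrenBudget v x = ∏children v (λ c → budget c x)

  childrenFree : Fin n → ℕ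
  childrenFree v = ∏children v (const free)

  RootBound : Set
  RootBound = ∀ v → parent v ≡ nothing →
    sum (map (λ x → unit * childrenBudget v x) rootCands) ≤ rootBudget * childrenFree v

  ChildBound : Set
  ChildBound = ∀ v u a → parent v ≡ just u →
    sum (map (λ x → unit * childrenBudget v x) (childCands v a)) ≤ budget v a * childrenFree v

  parent≢self : ∀ v → parent v ≢ just v
  parent≢self v pv≡v = ℕP.<-irrefl refl (height-dec pv≡v)

  ∏-updateAt-self : ∀ v g A → ∏ (updateAt (onChildren v g (const 1)) v (const A)) ≡ A * ∏children v g
  ∏-updateAt-self v g A = begin
    P                                ≡⟨ ℕP.*-identityʳ P ⟨
    P * 1                            ≡⟨ cong (P *_) (onChildren-other g (const 1) (parent≢self v)) ⟨
    P * onChildren v g (const 1) v   ≡⟨ ∏-updateAt (onChildren v g (const 1)) v A ⟩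
    A * ∏children v g                ∎
    where
    open ≡-Reasoning
    P : ℕ
    P = ∏ (updateAt (onChildren v g (const 1)) v (const A))

  module Extension (σ : Labelling) (v : Fin n) (σv≡nothing : lookup σ v ≡ nothing)
                   (children-unlabelled : ∀ c → parent c ≡ just v → lookup σ c ≡ nothing) where

    extend : Item → Labelling
    extend x = σ [ v ]≔ just x

    -- the factors of the potential that labelling v leaves unchanged
    elsewhere : Fin n → ℕ
    elsewhere = updateAt (onChildren v (const 1) (weight σ)) v (const 1)

    elsewhere-child : ∀ {c} → parent c ≡ just v → elsewhere c ≡ 1
    elsewhere-child {c} pc≡v = trans (updateAt-minimal c v _ (λ { refl → parent≢self c pc≡v }))
                                     (onChildren-child (const 1) (weight σ) pc≡v)

    elsewhere-other : ∀ {c} → c ≢ v → parent c ≢ just v → elsewhere c ≡ weight σ c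
    elsewhere-other {c} c≢v pc≢v = trans (updateAt-minimal c v _ c≢v) (onChildren-other (const 1) (weight σ) pc≢v)

    waiting-extend : ∀ x c mp → (∀ u → mp ≡ just u → u ≢ v) → waiting c mp (extend x) ≡ waiting c mp σ
    waiting-extend x c nothing  _      = refl
    waiting-extend x c (just u) mp≢v = cong (maybe′ (budget c) free) (lookup∘update′ (mp≢v u refl) σ (just x))

    weight-extend : ∀ x c →
      weight (extend x) c ≡ updateAt (onChildren v (λ c → budget c x) (const 1)) v (const unit) c * elsewhere c
    weight-extend x c with c F.≟ v
    ... | yes refl
      rewrite lookup∘update c σ (just x)
            | updateAt-updates c {const unit} (onChildren c (λ c → budget c x) (const 1))
            | updateAt-updates c {const 1} (onChildren c (const 1) (weight σ))
            = sym (ℕP.*-identityʳ unit)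
    ... | no c≢v with parent c ≟ₚ just v
    ...   | yes pc≡v = begin
      weight (extend x) c              ≡⟨ cong (maybe′ (const unit) _) (trans (lookup∘update′ c≢v σ (just x))
                                                                               (children-unlabelled c pc≡v)) ⟩
      waiting c (parent c) (extend x)  ≡⟨ cong (λ p → waiting c p (extend x)) pc≡v ⟩
      maybe′ (budget c) free (lookup (extend x) v)
                                       ≡⟨ cong (maybe′ (budget c) free) (lookup∘update v σ (just x)) ⟩
      budget c x                       ≡⟨ ℕP.*-identityʳ (budget c x) ⟨
      budget c x * 1                   ≡⟨ cong₂ _*_ (trans (updateAt-minimal c v _ c≢v)
                                                           (onChildren-child (λ c → budget c x) (const 1) pc≡v))
                                                    (elsewhere-child pc≡v) ⟨
      _                                ∎
      where open ≡-Reasoning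
    ...   | no pc≢v = begin
      weight (extend x) c  ≡⟨ cong₂ (maybe′ (const unit))
                                    (waiting-extend x c (parent c) (λ { u pc≡u refl → pc≢v pc≡u }))
                                    (lookup∘update′ c≢v σ (just x)) ⟩
      weight σ c           ≡⟨ ℕP.*-identityˡ (weight σ c) ⟨
      1 * weight σ c       ≡⟨ cong₂ _*_ (trans (updateAt-minimal c v _ c≢v)
                                               (onChildren-other (λ c → budget c x) (const 1) pc≢v))
                                        (elsewhere-other c≢v pc≢v) ⟨
      _                    ∎
      where open ≡-Reasoning

    weight-current : ∀ c →
      weight σ c ≡ updateAt (onChildren v (const free) (const 1)) v (const (waiting v (parent v) σ)) c * elsewhere c
    weight-current c with c F.≟ v
    ... | yes refl
      rewrite σv≡nothing
            | updateAt-updates c {const (waiting c (parent c) σ)} (onChildren c (const free) (const 1))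
            | updateAt-updates c {const 1} (onChildren c (const 1) (weight σ))
            = sym (ℕP.*-identityʳ _)
    ... | no c≢v with parent c ≟ₚ just v
    ...   | yes pc≡v = begin
      weight σ c          ≡⟨ cong (maybe′ (const unit) _) (children-unlabelled c pc≡v) ⟩
      waiting c (parent c) σ  ≡⟨ cong (λ p → waiting c p σ) pc≡v ⟩
      maybe′ (budget c) free (lookup σ v) ≡⟨ cong (maybe′ (budget c) free) σv≡nothing ⟩
      free                ≡⟨ ℕP.*-identityʳ free ⟨
      free * 1            ≡⟨ cong₂ _*_ (trans (updateAt-minimal c v _ c≢v) (onChildren-child (const free) (const 1) pc≡v))
                                       (elsewhere-child pc≡v) ⟨
      _                   ∎
      where open ≡-Reasoning
    ...   | no pc≢v = begin
      weight σ c      ≡⟨ ℕP.*-identityˡ (weight σ c) ⟨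
      1 * weight σ c  ≡⟨ cong₂ _*_ (trans (updateAt-minimal c v _ c≢v) (onChildren-other (const free) (const 1) pc≢v))
                                   (elsewhere-other c≢v pc≢v) ⟨
      _               ∎
      where open ≡-Reasoning

    potential-extend : ∀ x → potential (extend x) ≡ unit * childrenBudget v x * ∏ elsewhere
    potential-extend x = begin
      potential (extend x)
        ≡⟨ ∏-cong (weight-extend x) ⟩
      ∏ (λ c → updateAt (onChildren v (λ c → budget c x) (const 1)) v (const unit) c * elsewhere c)
        ≡⟨ ∏-distrib-* _ elsewhere ⟩
      ∏ (updateAt (onChildren v (λ c → budget c x) (const 1)) v (const unit)) * ∏ elsewhere
        ≡⟨ cong (_* ∏ elsewhere) (∏-updateAt-self v (λ c → budget c x) unit) ⟩
      unit * childrenBudget v x * ∏ elsewhere ∎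
      where open ≡-Reasoning

    potential-current : potential σ ≡ waiting v (parent v) σ * childrenFree v * ∏ elsewhere
    potential-current = begin
      potential σ
        ≡⟨ ∏-cong weight-current ⟩
      ∏ (λ c → updateAt (onChildren v (const free) (const 1)) v (const (waiting v (parent v) σ)) c * elsewhere c)
        ≡⟨ ∏-distrib-* _ elsewhere ⟩
      ∏ (updateAt (onChildren v (const free) (const 1)) v (const (waiting v (parent v) σ))) * ∏ elsewhere
        ≡⟨ cong (_* ∏ elsewhere) (∏-updateAt-self v (const free) (waiting v (parent v) σ)) ⟩
      waiting v (parent v) σ * childrenFree v * ∏ elsewhere ∎
      where open ≡-Reasoning

    candidates-bound : RootBound → ChildBound → ∀ mp → parent v ≡ mp →
      sum (map (λ x → unit * childrenBudget v x) (candidates v mp σ)) ≤ waiting v mp σ * childrenFree v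
    candidates-bound rootBound childBound nothing  pv≡nothing = rootBound v pv≡nothing
    candidates-bound rootBound childBound (just u) pv≡u with lookup σ u
    ... | nothing = z≤n
    ... | just a  = childBound v u a pv≡u

    potential-extensions : RootBound → ChildBound → sum (map potential (extensions v σ)) ≤ potential σ
    potential-extensions rootBound childBound = begin
      sum (map potential (extensions v σ))
        ≡⟨ cong sum (LP.map-∘ cands) ⟨
      sum (map (potential ∘ extend) cands)
        ≡⟨ cong sum (LP.map-cong potential-extend cands) ⟩
      sum (map (λ x → unit * childrenBudget v x * ∏ elsewhere) cands)
        ≡⟨ sum-map-*ʳ (λ x → unit * childrenBudget v x) (∏ elsewhere) cands ⟩
      sum (map (λ x → unit * childrenBudget v x) cands) * ∏ elsewhere
        ≤⟨ ℕP.*-monoˡ-≤ (∏ elsewhere) (candidates-bound rootBound childBound (parent v) refl) ⟩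
      waiting v (parent v) σ * childrenFree v * ∏ elsewhere
        ≡⟨ potential-current ⟨
      potential σ ∎
      where
      open ℕP.≤-Reasoning
      cands : List Item
      cands = candidates v (parent v) σ

  potential-unlabelled : potential unlabelled * free ≡ rootBudget * free ^ n
  potential-unlabelled = begin
    potential unlabelled * free                              ≡⟨ cong (_* free) (∏-cong weight-unlabelled) ⟩
    ∏ (updateAt (const free) root (const rootBudget)) * free ≡⟨ ∏-updateAt (const free) root rootBudget ⟩
    rootBudget * ∏ {n} (const free)                          ≡⟨ cong (rootBudget *_) (∏-const {n} free) ⟩
    rootBudget * free ^ n                                    ∎
    where
    open ≡-Reasoning
    weight-unlabelled : ∀ c → weight unlabelled c ≡ updateAt (const free) root (const rootBudget) c
    weight-unlabelled c rewrite lookup-replicate c (nothing {A = Item}) with c F.≟ root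
    ... | yes refl rewrite parent-root = sym (updateAt-updates root (const free))
    ... | no c≢root with has-parent c c≢root
    ...   | u , pc≡u rewrite pc≡u | lookup-replicate u (nothing {A = Item}) =
      sym (updateAt-minimal c root (const free) c≢root)

  rank : Fin n → ℕ
  rank v = height v * n + toℕ v

  rank-height-mono : ∀ {u v} → height u < height v → rank u < rank v
  rank-height-mono {u} {v} hu<hv = begin-strict
    height u * n + toℕ u  <⟨ ℕP.+-monoʳ-< (height u * n) (FP.toℕ<n u) ⟩
    height u * n + n      ≡⟨ ℕP.+-comm (height u * n) n ⟩
    suc (height u) * n    ≤⟨ ℕP.*-monoˡ-≤ n hu<hv ⟩
    height v * n          ≤⟨ ℕP.m≤m+n (height v * n) (toℕ v) ⟩
    rank v                ∎
    where open ℕP.≤-Reasoning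

  rank-parent : ∀ {u v} → parent v ≡ just u → rank u < rank v
  rank-parent pv≡u = rank-height-mono (height-dec pv≡u)

  rank-injective : ∀ {u v} → rank u ≡ rank v → u ≡ v
  rank-injective {u} {v} ru≡rv with ℕP.<-cmp (height u) (height v)
  ... | tri< hu<hv _ _ = ⊥-elim (ℕP.<-irrefl ru≡rv (rank-height-mono hu<hv))
  ... | tri> _ _ hv<hu = ⊥-elim (ℕP.<-irrefl (sym ru≡rv) (rank-height-mono hv<hu))
  ... | tri≈ _ hu≡hv _ = FP.toℕ-injective (ℕP.+-cancelˡ-≡ (height u * n) _ _
                           (trans ru≡rv (cong (λ h → h * n + toℕ v) (sym hu≡hv))))

  <-suc-≢ : ∀ {c t} → rank c < suc t → rank c ≢ t → rank c < t
  <-suc-≢ rc<1+t rc≢t = ℕP.≤∧≢⇒< (ℕP.≤-pred rc<1+t) rc≢t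

  vertexOfRank? : ∀ t → Dec (∃ λ v → rank v ≡ t)
  vertexOfRank? t = FP.any? (λ v → rank v ≟ t)

  extendAll : ∀ {t} → Dec (∃ λ v → rank v ≡ t) → List Labelling → List Labelling
  extendAll (yes (v , _)) σs = concatMap (extensions v) σs
  extendAll (no _)        σs = σs

  enumeration : ℕ → List Labelling
  enumeration zero    = unlabelled ∷ []
  enumeration (suc t) = extendAll (vertexOfRank? t) (enumeration t)

  LabelledBelow : ℕ → Labelling → Set
  LabelledBelow t σ = ∀ c → (rank c < t → ∃ λ x → lookup σ c ≡ just x) × (t ≤ rank c → lookup σ c ≡ nothing)

  labelledBelow-zero : LabelledBelow 0 unlabelled
  labelledBelow-zero c = (λ ()) , λ _ → lookup-replicate c nothing

  labelledBelow-extend : ∀ {t v σ} → rank v ≡ t → LabelledBelow t σ → ∀ x → LabelledBelow (suc t) (σ [ v ]≔ just x)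
  labelledBelow-extend {t} {v} {σ} rv≡t below x c with c F.≟ v
  ... | yes refl = (λ _ → x , lookup∘update c σ (just x)) , λ t<rc → ⊥-elim (ℕP.<-irrefl (sym rv≡t) t<rc)
  ... | no c≢v   =
    (λ rc<1+t → let y , σc≡y = proj₁ (below c) (<-suc-≢ rc<1+t (c≢v ∘ rank-injective ∘ (λ e → trans e (sym rv≡t))))
                in y , trans (lookup∘update′ c≢v σ (just x)) σc≡y) ,
    (λ t<rc → trans (lookup∘update′ c≢v σ (just x)) (proj₂ (below c) (ℕP.<⇒≤ t<rc)))

  labelledBelow-skip : ∀ {t σ} → ¬ (∃ λ v → rank v ≡ t) → LabelledBelow t σ → LabelledBelow (suc t) σ
  labelledBelow-skip no-vertex below c =
    (λ rc<1+t → proj₁ (below c) (<-suc-≢ rc<1+t (λ rc≡t → no-vertex (c , rc≡t)))) ,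
    (λ t<rc → proj₂ (below c) (ℕP.<⇒≤ t<rc))

  enumeration-labelledBelow : ∀ t → All (LabelledBelow t) (enumeration t)
  enumeration-labelledBelow zero    = labelledBelow-zero ∷ []
  enumeration-labelledBelow (suc t) with vertexOfRank? t
  ... | yes (v , rv≡t) = concat⁺ (map⁺ (All.map extensions-labelledBelow (enumeration-labelledBelow t)))
    where
    extensions-labelledBelow : ∀ {σ} → LabelledBelow t σ → All (LabelledBelow (suc t)) (extensions v σ)
    extensions-labelledBelow {σ} below = map⁺ (All.universal (labelledBelow-extend {σ = σ} rv≡t below) _)
  ... | no no-vertex   = All.map (λ {σ} → labelledBelow-skip {σ = σ} no-vertex) (enumeration-labelledBelow t)

  potential-enumeration : RootBound → ChildBound → ∀ t → sum (map potential (enumeration t)) ≤ potential unlabelled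
  potential-enumeration rootBound childBound zero    = ℕP.≤-reflexive (ℕP.+-identityʳ _)
  potential-enumeration rootBound childBound (suc t) =
    ℕP.≤-trans (extendAll-bound (vertexOfRank? t)) (potential-enumeration rootBound childBound t)
    where
    extendAll-bound : ∀ (v? : Dec (∃ λ v → rank v ≡ t)) →
                      sum (map potential (extendAll v? (enumeration t))) ≤ sum (map potential (enumeration t))
    extendAll-bound (yes (v , rv≡t)) = begin
      sum (map potential (concatMap (extensions v) (enumeration t)))
        ≡⟨ sum-map-concatMap potential (extensions v) (enumeration t) ⟩
      sum (map (λ σ → sum (map potential (extensions v σ))) (enumeration t))
        ≤⟨ sum-map-mono-≤ extension-bound (enumeration-labelledBelow t) ⟩
      sum (map potential (enumeration t)) ∎
      where
      open ℕP.≤-Reasoning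
      extension-bound : ∀ {σ} → LabelledBelow t σ → sum (map potential (extensions v σ)) ≤ potential σ
      extension-bound {σ} below =
        Extension.potential-extensions σ v
          (proj₂ (below v) (ℕP.≤-reflexive (sym rv≡t)))
          (λ c pc≡v → proj₂ (below c) (ℕP.<⇒≤ (subst (_< rank c) rv≡t (rank-parent pc≡v))))
          rootBound childBound
    extendAll-bound (no _) = ℕP.≤-refl

  record Admissible (τ : Vec Item n) : Set where
    field
      root-admissible  : ∀ v → parent v ≡ nothing → lookup τ v ∈ rootCands
      child-admissible : ∀ v u → parent v ≡ just u → lookup τ v ∈ childCands v (lookup τ u)

  module Restriction (τ : Vec Item n) where

    restrict : ℕ → Labelling
    restrict t = tabulate (λ c → if does (rank c <? t) then just (lookup τ c) else nothing)

    restrict-below : ∀ {c t} → rank c < t → lookup (restrict t) c ≡ just (lookup τ c)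
    restrict-below {c} {t} rc<t = trans (lookup∘tabulate _ c)
      (cong (λ b → if b then just (lookup τ c) else nothing) (dec-true (rank c <? t) rc<t))

    restrict-above : ∀ {c t} → ¬ rank c < t → lookup (restrict t) c ≡ nothing
    restrict-above {c} {t} rc≮t = trans (lookup∘tabulate _ c)
      (cong (λ b → if b then just (lookup τ c) else nothing) (dec-false (rank c <? t) rc≮t))

    restrict-suc-other : ∀ {c t} → rank c ≢ t → lookup (restrict (suc t)) c ≡ lookup (restrict t) c
    restrict-suc-other {c} {t} rc≢t with rank c <? t
    ... | yes rc<t = trans (restrict-below (ℕP.m<n⇒m<1+n rc<t)) (sym (restrict-below rc<t))
    ... | no  rc≮t = trans (restrict-above (λ rc<1+t → rc≮t (<-suc-≢ rc<1+t rc≢t))) (sym (restrict-above rc≮t))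

    restrict-zero : restrict 0 ≡ unlabelled
    restrict-zero = lookup-extensionality _ _ λ c →
      trans (restrict-above {t = 0} (λ ())) (sym (lookup-replicate c nothing))

    restrict-suc-rank : ∀ {t v} → rank v ≡ t → restrict (suc t) ≡ restrict t [ v ]≔ just (lookup τ v)
    restrict-suc-rank {t} {v} rv≡t = lookup-extensionality _ _ lookup-eq
      where
      lookup-eq : ∀ c → lookup (restrict (suc t)) c ≡ lookup (restrict t [ v ]≔ just (lookup τ v)) c
      lookup-eq c with c F.≟ v
      ... | yes refl = trans (restrict-below (ℕP.≤-reflexive (cong suc rv≡t)))
                             (sym (lookup∘update c (restrict t) (just (lookup τ c))))
      ... | no  c≢v  = trans (restrict-suc-other (λ rc≡t → c≢v (rank-injective (trans rc≡t (sym rv≡t)))))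
                             (sym (lookup∘update′ c≢v (restrict t) (just (lookup τ v))))

    restrict-suc-skip : ∀ {t} → ¬ (∃ λ v → rank v ≡ t) → restrict (suc t) ≡ restrict t
    restrict-suc-skip no-vertex = lookup-extensionality _ _ λ c → restrict-suc-other (λ rc≡t → no-vertex (c , rc≡t))

    restrict-complete : ∀ {t} → (∀ c → rank c < t) → restrict t ≡ V.map just τ
    restrict-complete all-below = lookup-extensionality _ _ λ c →
      trans (restrict-below (all-below c)) (sym (lookup-map c just τ))

    module _ (admissible : Admissible τ) where
      open Admissible admissible

      restrict-∈-candidates : ∀ {t v} → rank v ≡ t → lookup τ v ∈ candidates v (parent v) (restrict t)
      restrict-∈-candidates {t} {v} rv≡t with parent v in pv
      ... | nothing = root-admissible v pv
      ... | just u  rewrite restrict-below (subst (rank u <_) rv≡t (rank-parent pv)) =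
        child-admissible v u pv

      restrict-∈-enumeration : ∀ t → restrict t ∈ enumeration t
      restrict-∈-enumeration zero    = subst (_∈ enumeration 0) (sym restrict-zero) (here refl)
      restrict-∈-enumeration (suc t) with vertexOfRank? t
      ... | yes (v , rv≡t) = subst (_∈ concatMap (extensions v) (enumeration t)) (sym (restrict-suc-rank rv≡t))
              (∈-concatMap⁺ (extensions v) (Any.map (λ { refl → ∈-map⁺ _ (restrict-∈-candidates rv≡t) })
                                     (restrict-∈-enumeration t)))
      ... | no no-vertex   = subst (_∈ enumeration t) (sym (restrict-suc-skip no-vertex)) (restrict-∈-enumeration t)

  count-admissible : RootBound → ChildBound → (τs : List (Vec Item n)) → Unique τs → All Admissible τs →
                     length τs * unit ^ n ≤ potential unlabelled
  count-admissible rootBound childBound τs τs! τs-admissible = begin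
    length τs * unit ^ n                       ≡⟨ cong (_* unit ^ n) (LP.length-map (V.map just) τs) ⟨
    length (map (V.map just) τs) * unit ^ n    ≤⟨ ℕP.*-monoˡ-≤ (unit ^ n)
                                                    (unique-⊆⇒length≤ (Unique.map⁺ map-just-injective τs!) ⊆enumeration) ⟩
    length (enumeration R) * unit ^ n          ≡⟨ sum-map-const (All.map (λ {σ} → complete-potential {σ}) (enumeration-labelledBelow R)) ⟨
    sum (map potential (enumeration R))        ≤⟨ potential-enumeration rootBound childBound R ⟩
    potential unlabelled                       ∎
    where
    open ℕP.≤-Reasoning
    R : ℕ
    R = proj₁ (bounded rank)
    below-R : ∀ c → rank c < R
    below-R = proj₂ (bounded rank)

    map-just-injective : ∀ {τ τ′ : Vec Item n} → V.map just τ ≡ V.map just τ′ → τ ≡ τ′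
    map-just-injective {τ} {τ′} eq = lookup-extensionality τ τ′ λ c →
      just-injective (trans (sym (lookup-map c just τ)) (trans (cong (λ σ → lookup σ c) eq) (lookup-map c just τ′)))

    ⊆enumeration : ∀ {σ} → σ ∈ map (V.map just) τs → σ ∈ enumeration R
    ⊆enumeration σ∈ with ∈-map⁻ (V.map just) σ∈
    ... | τ , τ∈τs , refl = subst (_∈ enumeration R) (Restriction.restrict-complete τ below-R)
                               (Restriction.restrict-∈-enumeration τ (All.lookup τs-admissible τ∈τs) R)

    complete-potential : ∀ {σ} → LabelledBelow R σ → potential σ ≡ unit ^ n
    complete-potential {σ} below = trans (∏-cong weight-unit) (∏-const {n} unit)
      where
      weight-unit : ∀ c → weight σ c ≡ unit
      weight-unit c with proj₁ (below c) (below-R c)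
      ... | _ , σc≡x = cong (maybe′ (const unit) _) σc≡x

  onChildren-mono-≤ : ∀ v {g h} → (∀ c → g c ≤ h c) → ∀ c → onChildren v g (const 1) c ≤ onChildren v h (const 1) c
  onChildren-mono-≤ v g≤h c with isChildOf v c
  ... | true  = g≤h c
  ... | false = ℕP.≤-refl

  ∏children-mono-≤ : ∀ v {g h} → (∀ c → g c ≤ h c) → ∏children v g ≤ ∏children v h
  ∏children-mono-≤ v g≤h = ∏-mono-≤ (onChildren-mono-≤ v g≤h)

  ∏children-mono-≤-at : ∀ v {g h} A B → (∀ c → g c ≤ h c) → ∀ {c} → parent c ≡ just v →
                        A * g c ≤ B * h c → A * ∏children v g ≤ B * ∏children v h
  ∏children-mono-≤-at v {g} {h} A B g≤h {c} pc≡v Ag≤Bh = ∏-mono-≤-at A B (onChildren-mono-≤ v g≤h) c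
    (subst₂ (λ x y → A * x ≤ B * y) (sym (onChildren-child g (const 1) pc≡v)) (sym (onChildren-child h (const 1) pc≡v)) Ag≤Bh)

module IntegerWindows where
  open import Data.Nat as ℕ using (suc; z≤n; s≤s)
  import Data.Nat.Properties as ℕP
  open import Data.Integer as ℤ using (ℤ; +_; -[1+_]; _≤_; _+_; _-_; -_; +≤+; -≤-)
  import Data.Integer.Properties as ℤP
  open import Data.Integer.Tactic.RingSolver using (solve-∀)
  open import Data.Sum using (_⊎_; inj₁; inj₂)
  open import Data.Empty using (⊥-elim)
  open import Relation.Nullary using (¬_)
  open import Relation.Binary.PropositionalEquality

  +-cancelˡ-≤ : ∀ i {j k} → i + j ≤ i + k → j ≤ k
  +-cancelˡ-≤ i {j} {k} i+j≤i+k = subst₂ _≤_ (cancel j) (cancel k) (ℤP.+-monoʳ-≤ (- i) i+j≤i+k)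
    where
    cancel : ∀ x → - i + (i + x) ≡ x
    cancel x = trans (sym (ℤP.+-assoc (- i) i x)) (trans (cong (_+ x) (ℤP.+-inverseˡ i)) (ℤP.+-identityˡ x))

  +-cancelʳ-≤ : ∀ k {i j} → i + k ≤ j + k → i ≤ j
  +-cancelʳ-≤ k {i} {j} i+k≤j+k = +-cancelˡ-≤ k (subst₂ _≤_ (ℤP.+-comm i k) (ℤP.+-comm j k) i+k≤j+k)

  private
    offset : ∀ j x → x ≡ j + (x - j)
    offset = solve-∀

    shift : ∀ j d k → (j + d) + k ≡ j + (d + k)
    shift = solve-∀

    k+1≰0 : ∀ k → ¬ (k ℕ.+ 1 ℕ.≤ 0)
    k+1≰0 k k+1≤0 = ℕP.n≮0 (subst (ℕ._≤ 0) (ℕP.+-comm k 1) k+1≤0)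

  window₂ : ∀ j x → j ≤ x → x + + 1 ≤ j + + 2 → x ≡ j ⊎ x ≡ j + + 1
  window₂ j x j≤x x+1≤j+2 = by-offset (x - j) (offset j x)
    (+-cancelˡ-≤ j (subst₂ _≤_ (sym (ℤP.+-identityʳ j)) (offset j x) j≤x))
    (+-cancelˡ-≤ j (subst (_≤ j + + 2) (trans (cong (_+ + 1) (offset j x)) (shift j (x - j) (+ 1))) x+1≤j+2))
    where
    by-offset : ∀ d → x ≡ j + d → + 0 ≤ d → d + + 1 ≤ + 2 → x ≡ j ⊎ x ≡ j + + 1
    by-offset (+ 0)           x≡j+d _ _ = inj₁ (trans x≡j+d (ℤP.+-identityʳ j))
    by-offset (+ 1)           x≡j+d _ _ = inj₂ x≡j+d
    by-offset (+ suc (suc k)) _     _ (+≤+ (s≤s (s≤s k+1≤0))) = ⊥-elim (k+1≰0 k k+1≤0)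
    by-offset -[1+ k ]        _     () _

  window₄ : ∀ j x → j - + 1 ≤ x → x + + 1 ≤ j + + 3 →
            x ≡ j - + 1 ⊎ x ≡ j ⊎ x ≡ j + + 1 ⊎ x ≡ j + + 2
  window₄ j x j-1≤x x+1≤j+3 = by-offset (x - j) (offset j x)
    (+-cancelˡ-≤ j (subst (j - + 1 ≤_) (offset j x) j-1≤x))
    (+-cancelˡ-≤ j (subst (_≤ j + + 3) (trans (cong (_+ + 1) (offset j x)) (shift j (x - j) (+ 1))) x+1≤j+3))
    where
    by-offset : ∀ d → x ≡ j + d → -[1+ 0 ] ≤ d → d + + 1 ≤ + 3 →
                x ≡ j - + 1 ⊎ x ≡ j ⊎ x ≡ j + + 1 ⊎ x ≡ j + + 2
    by-offset -[1+ 0 ]             x≡j+d _ _ = inj₁ x≡j+d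
    by-offset (+ 0)                x≡j+d _ _ = inj₂ (inj₁ (trans x≡j+d (ℤP.+-identityʳ j)))
    by-offset (+ 1)                x≡j+d _ _ = inj₂ (inj₂ (inj₁ x≡j+d))
    by-offset (+ 2)                x≡j+d _ _ = inj₂ (inj₂ (inj₂ x≡j+d))
    by-offset (+ suc (suc (suc k))) _    _ (+≤+ (s≤s (s≤s (s≤s k+1≤0)))) = ⊥-elim (k+1≰0 k k+1≤0)
    by-offset -[1+ suc k ]         _     (-≤- ()) _

  i+m≰i+n : ∀ i {m n} → n ℤ.< m → ¬ (i + m ≤ i + n)
  i+m≰i+n i n<m i+m≤i+n = ℤP.<⇒≱ n<m (+-cancelˡ-≤ i i+m≤i+n)

  i≰i-1 : ∀ i → ¬ (i ≤ i - + 1)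
  i≰i-1 i i≤i-1 = i+m≰i+n i (ℤ.-<+ {0} {0}) (subst (_≤ i - + 1) (sym (ℤP.+-identityʳ i)) i≤i-1)

  i+1≰i : ∀ i → ¬ (i + + 1 ≤ i)
  i+1≰i i i+1≤i = i+m≰i+n i (ℤ.+<+ (s≤s z≤n)) (subst (i + + 1 ≤_) (sym (ℤP.+-identityʳ i)) i+1≤i)

  i+2≰i+1 : ∀ i → ¬ (i + + 2 ≤ i + + 1)
  i+2≰i+1 i = i+m≰i+n i (ℤ.+<+ (s≤s (s≤s z≤n)))

  i+1≰i-1+1 : ∀ i → ¬ (i + + 1 ≤ i - + 1 + + 1)
  i+1≰i-1+1 i i+1≤i-1+1 = i+1≰i i (subst (i + + 1 ≤_) (i-1+1≡i i) i+1≤i-1+1)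
    where
    i-1+1≡i : ∀ i → i - + 1 + + 1 ≡ i
    i-1+1≡i = solve-∀

  pos-≤-suc : ∀ {a c x y} → a ℕ.≤ suc c → + a ≡ x → + c ≡ y → x ≤ y + + 1
  pos-≤-suc {a} {c} a≤1+c refl refl = +≤+ (subst (a ℕ.≤_) (ℕP.+-comm 1 c) a≤1+c)

module Candidates where
  open import Data.Nat using (suc; _≤_; _*_; _+_)
  open import Data.Nat.Properties as ℕP using (+-mono-≤)
  open import Data.Nat.ListAction using (sum)
  open import Data.Nat.Tactic.RingSolver using (solve-∀)
  open import Data.Integer as ℤ using (ℤ; +_; -[1+_])
  open import Data.Bool using (Bool; true; false)
  open import Data.Fin as F using ()
  import Data.Fin.Properties as FP
  open import Data.Maybe using (Maybe; just; nothing)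
  open import Data.Maybe.Properties using () renaming (≡-dec to ≡-dec-Maybe)
  open import Data.List using ([]; _∷_; length; map; concatMap; applyUpTo)
  import Data.List.Properties as LP
  open import Data.Product using (∃-syntax; _×_; _,_; proj₁; proj₂)
  open import Relation.Nullary using (¬_; Dec; yes; no; does)
  open import Relation.Nullary.Decidable using (¬?; _×-dec_; decidable-stable; dec-true)
  open import Relation.Binary.PropositionalEquality
  open BigOperators

  -- The item of a vertex v is (φ(v), s(v)): the index pair (i , j) of φ(v) = Θ_(i,j) and the
  -- index k of s(v) = Θ_k, if defined.
  Item : Set
  Item = (ℤ × ℤ) × Maybe ℤ

  sitsLow : Item → Bool
  sitsLow ((lo , _) , just k) = does (k ℤ.≟ lo)
  sitsLow (_        , nothing) = false

  innerItem : ℤ → Maybe ℤ → Item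
  innerItem j m = ((j , j ℤ.+ + 2) , m)

  sitsLow-self : ∀ j → sitsLow (innerItem j (just j)) ≡ true
  sitsLow-self j = dec-true (j ℤ.≟ j) refl

  -- The items allowed for an inner child of a vertex with φ = Θ_(lo,lo+2), depending on whether the
  -- parent's state is its lower base segment Θ_lo.
  innerCands : Bool → ℤ → List Item
  innerCands true  lo = innerItem (lo ℤ.- + 1) nothing
                      ∷ innerItem (lo ℤ.- + 1) (just (lo ℤ.- + 1))
                      ∷ innerItem (lo ℤ.- + 1) (just (lo ℤ.- + 1 ℤ.+ + 1))
                      ∷ innerItem (lo ℤ.+ + 1) (just (lo ℤ.+ + 1))
                      ∷ []
  innerCands false lo = innerItem (lo ℤ.- + 1) nothing
                      ∷ innerItem (lo ℤ.- + 1) (just (lo ℤ.- + 1 ℤ.+ + 1))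
                      ∷ innerItem (lo ℤ.+ + 1) nothing
                      ∷ innerItem (lo ℤ.+ + 1) (just (lo ℤ.+ + 1))
                      ∷ innerItem (lo ℤ.+ + 1) (just (lo ℤ.+ + 1 ℤ.+ + 1))
                      ∷ []

  leafStates : Bool → ℤ → List (Maybe ℤ)
  leafStates true  lo = nothing ∷ just (lo ℤ.- + 1) ∷ just lo ∷ just (lo ℤ.+ + 1) ∷ []
  leafStates false lo = nothing ∷ just lo ∷ just (lo ℤ.+ + 1) ∷ just (lo ℤ.+ + 2) ∷ []

  leafCands : Bool → ℤ → List Item
  leafCands low lo = map ((lo ℤ.- + 1 , lo ℤ.+ + 3) ,_) (leafStates low lo)

  length-leafCands : ∀ low lo → length (leafCands low lo) ≡ 4
  length-leafCands true  lo = refl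
  length-leafCands false lo = refl

  rootItems : ℤ → List Item
  rootItems i = innerItem i nothing ∷ innerItem i (just i) ∷ innerItem i (just (i ℤ.+ + 1)) ∷ []

  rootLows : ℕ → List ℤ
  rootLows n = -[1+ 0 ] ∷ applyUpTo +_ n

  rootCands : ℕ → List Item
  rootCands n = concatMap rootItems (rootLows n)

  35*w≤29*z : ∀ w z → 169 * w ≤ 140 * z → 35 * w ≤ 29 * z
  35*w≤29*z w z 169w≤140z = ℕP.*-cancelˡ-≤ 169 (begin
    169 * (35 * w)  ≡⟨ reorder w ⟩
    35 * (169 * w)  ≤⟨ ℕP.*-monoʳ-≤ 35 169w≤140z ⟩
    35 * (140 * z)  ≡⟨ to-4900 z ⟩
    4900 * z        ≤⟨ ℕP.*-monoˡ-≤ z (ℕP.n≤1+n 4900) ⟩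
    4901 * z        ≡⟨ from-4901 z ⟩
    169 * (29 * z)  ∎)
    where
    open ℕP.≤-Reasoning
    reorder : ∀ w → 169 * (35 * w) ≡ 35 * (169 * w)
    reorder = solve-∀
    to-4900 : ∀ z → 35 * (140 * z) ≡ 4900 * z
    to-4900 = solve-∀
    from-4901 : ∀ z → 4901 * z ≡ 169 * (29 * z)
    from-4901 = solve-∀

  module Weights {n : ℕ} {G : Graph n} (D : RootedSpanningTree G) where
    open RootedSpanningTree D

    leaf? : ∀ v → Dec (IsLeaf D v)
    leaf? v = ¬? (v F.≟ root) ×-dec FP.all? (λ w → ¬? (≡-dec-Maybe F._≟_ (parent w) (just v)))

    childCandsFor : ∀ {v} → Dec (IsLeaf D v) → Item → List Item
    childCandsFor (yes _) a = leafCands  (sitsLow a) (proj₁ (proj₁ a))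
    childCandsFor (no _)  a = innerCands (sitsLow a) (proj₁ (proj₁ a))

    -- Each budget is the value for which labelling the vertex keeps the potential from increasing:
    -- a leaf has 4 candidates (4 · 35 = 140); an inner vertex has 4 candidates, 2 of them sitting
    -- low, below a low parent (35 + 29 + 35 + 29 = 128), and 5 candidates, 1 sitting low, otherwise
    -- (4 · 35 + 29 = 169).  A low candidate costs only 29 because some child's budget is at most 140.
    innerBudget : Bool → ℕ
    innerBudget true  = 128
    innerBudget false = 169

    budgetFor : ∀ {v} → Dec (IsLeaf D v) → Item → ℕ
    budgetFor (yes _) a = 140
    budgetFor (no _)  a = innerBudget (sitsLow a)

    childCands : Fin n → Item → List Item
    childCands v = childCandsFor (leaf? v)

    budget : Fin n → Item → ℕ
    budget v = budgetFor (leaf? v)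

    rootBudget : ℕ
    rootBudget = 3 * (n + 1) * 169

    open TreeLabellings D 35 169 (rootCands n) rootBudget childCands budget public

    budget≤169 : ∀ c a → budget c a ≤ 169
    budget≤169 c = budgetFor≤169 (leaf? c)
      where
      budgetFor≤169 : ∀ {v} (leaf : Dec (IsLeaf D v)) a → budgetFor leaf a ≤ 169
      budgetFor≤169 (yes _) a = ℕP.m≤m+n 140 29
      budgetFor≤169 (no _)  a with sitsLow a
      ... | true  = ℕP.m≤m+n 128 41
      ... | false = ℕP.≤-refl

    budget-low : ∀ c a → sitsLow a ≡ true → 169 * budget c a ≤ 140 * 169
    budget-low c = budgetFor-low (leaf? c)
      where
      budgetFor-low : ∀ {v} (leaf : Dec (IsLeaf D v)) a → sitsLow a ≡ true → 169 * budgetFor leaf a ≤ 140 * 169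
      budgetFor-low (yes _) a _ = ℕP.≤-reflexive (ℕP.*-comm 169 140)
      budgetFor-low (no _)  a low rewrite low = ℕP.m≤m+n (169 * 128) 2028

    inner-has-child : ∀ {u v} → parent v ≡ just u → ¬ IsLeaf D v → ∃[ c ] parent c ≡ just v
    inner-has-child {u} {v} pv≡u ¬leaf =
      let c , ¬pc≢v = FP.¬∀⟶∃¬ n (λ w → parent w ≢ just v) (λ w → ¬? (parent w ≟ₚ just v)) (λ no-child → ¬leaf (v≢root , no-child))
      in  c , decidable-stable (parent c ≟ₚ just v) ¬pc≢v
      where
      v≢root : v ≢ root
      v≢root refl with trans (sym parent-root) pv≡u
      ... | ()

    module LocalBounds (v : Fin n) where

      term : Item → ℕ
      term x = 35 * childrenBudget v x

      term≤ : ∀ x → term x ≤ 35 * childrenFree v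
      term≤ x = ℕP.*-monoʳ-≤ 35 (∏children-mono-≤ v (λ c → budget≤169 c x))

      low-term≤ : ∀ {c} → parent c ≡ just v → ∀ x → sitsLow x ≡ true → term x ≤ 29 * childrenFree v
      low-term≤ {c} pc≡v x low = 35*w≤29*z (childrenBudget v x) (childrenFree v)
        (∏children-mono-≤-at v 169 140 (λ c → budget≤169 c x) pc≡v (budget-low c x low))

      root-bound : sum (map term (rootCands n)) ≤ rootBudget * childrenFree v
      root-bound = begin
        sum (map term (rootCands n))
          ≡⟨ sum-map-concatMap term rootItems (rootLows n) ⟩
        sum (map (λ i → sum (map term (rootItems i))) (rootLows n))
          ≤⟨ sum-map-≤ (rootLows n) (λ i → sum-map-≤ (rootItems i) term≤) ⟩
        length (rootLows n) * (3 * (35 * childrenFree v))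
          ≡⟨ cong (λ k → suc k * (3 * (35 * childrenFree v))) (LP.length-applyUpTo +_ n) ⟩
        suc n * (3 * (35 * childrenFree v))
          ≡⟨ regroup n (childrenFree v) ⟩
        3 * (n + 1) * 35 * childrenFree v
          ≤⟨ ℕP.*-monoˡ-≤ (childrenFree v) (ℕP.*-monoʳ-≤ (3 * (n + 1)) (ℕP.m≤m+n 35 134)) ⟩
        rootBudget * childrenFree v ∎
        where
        open ℕP.≤-Reasoning
        regroup : ∀ n z → suc n * (3 * (35 * z)) ≡ 3 * (n + 1) * 35 * z
        regroup = solve-∀

      leaf-bound : ∀ low lo → sum (map term (leafCands low lo)) ≤ 140 * childrenFree v
      leaf-bound low lo = begin
        sum (map term (leafCands low lo))          ≤⟨ sum-map-≤ (leafCands low lo) term≤ ⟩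
        length (leafCands low lo) * (35 * childrenFree v) ≡⟨ cong (_* (35 * childrenFree v)) (length-leafCands low lo) ⟩
        4 * (35 * childrenFree v)                    ≡⟨ ℕP.*-assoc 4 35 (childrenFree v) ⟨
        140 * childrenFree v                         ∎
        where open ℕP.≤-Reasoning

      inner-bound : ∀ {c} → parent c ≡ just v → ∀ low lo → sum (map term (innerCands low lo)) ≤ innerBudget low * childrenFree v
      inner-bound pc≡v true lo = begin
        sum (map term (innerCands true lo))
          ≤⟨ +-mono-≤ (term≤ _) (+-mono-≤ (low-term≤ pc≡v _ (sitsLow-self (lo ℤ.- + 1)))
               (+-mono-≤ (term≤ _) (+-mono-≤ (low-term≤ pc≡v _ (sitsLow-self (lo ℤ.+ + 1))) ℕP.≤-refl))) ⟩
        35 * z + (29 * z + (35 * z + (29 * z + 0)))  ≡⟨ add-up z ⟩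
        128 * z                                    ∎
        where
        open ℕP.≤-Reasoning
        z : ℕ
        z = childrenFree v
        add-up : ∀ z → 35 * z + (29 * z + (35 * z + (29 * z + 0))) ≡ 128 * z
        add-up = solve-∀
      inner-bound pc≡v false lo = begin
        sum (map term (innerCands false lo))
          ≤⟨ +-mono-≤ (term≤ _) (+-mono-≤ (term≤ _) (+-mono-≤ (term≤ _)
               (+-mono-≤ (low-term≤ pc≡v _ (sitsLow-self (lo ℤ.+ + 1))) (+-mono-≤ (term≤ _) ℕP.≤-refl)))) ⟩
        35 * z + (35 * z + (35 * z + (29 * z + (35 * z + 0))))  ≡⟨ add-up z ⟩
        169 * z                                                ∎
        where
        open ℕP.≤-Reasoning
        z : ℕ
        z = childrenFree v
        add-up : ∀ z → 35 * z + (35 * z + (35 * z + (29 * z + (35 * z + 0)))) ≡ 169 * z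
        add-up = solve-∀

    rootBound : RootBound
    rootBound v _ = LocalBounds.root-bound v

    childBound : ChildBound
    childBound v u a pv≡u = bound-for (leaf? v)
      where
      open LocalBounds v
      bound-for : (leaf : Dec (IsLeaf D v)) →
                  sum (map term (childCandsFor leaf a)) ≤ budgetFor leaf a * childrenFree v
      bound-for (yes _)    = leaf-bound (sitsLow a) (proj₁ (proj₁ a))
      bound-for (no ¬leaf) = inner-bound (proj₂ (inner-has-child pv≡u ¬leaf)) (sitsLow a) (proj₁ (proj₁ a))

module Consistency {n : ℕ} (b : ℕ) {G : Graph n} (D : RootedSpanningTree G) where
  open import Data.Nat as ℕ using (suc; z≤n; s≤s)
  import Data.Nat.Properties as ℕP
  open import Data.Nat.DivMod using (m/n*n≤m)
  open import Data.Nat.Tactic.RingSolver using (solve-∀)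
  open import Data.Integer as ℤ using (ℤ; +_; -[1+_]; _≤_; _+_; _-_; _*_; +≤+; -≤-)
  import Data.Integer.Properties as ℤP
  open import Data.Fin as F using ()
  open import Data.Maybe as Maybe using (Maybe; just; nothing)
  open import Data.Maybe.Properties using (just-injective)
  open import Data.Vec as V using (Vec; lookup)
  open import Data.Vec.Properties using (lookup-replicate; lookup∘tabulate)
  open import Data.List.Membership.Propositional using (_∈_)
  open import Data.List.Membership.Propositional.Properties using (∈-map⁺; ∈-applyUpTo⁺; ∈-concatMap⁺)
  open import Data.List.Relation.Unary.Any as Any using (here; there)
  open import Data.Product using (_×_; _,_; proj₁; proj₂)
  open import Data.Sum as Sum using (_⊎_; inj₁; inj₂)
  open import Data.Unit using (⊤; tt)
  open import Data.Empty using (⊥-elim)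
  open import Relation.Nullary using (¬_; Dec; yes; no)
  open import Relation.Binary.PropositionalEquality
  open BigOperators
  open IntegerWindows
  open Candidates
  open Graph G using (E)

  -- Within (lo , hi) (just c) says Θ_c ⊆ Θ_(lo,hi), read off the indices.
  Within : ℤ × ℤ → Maybe ℕ → Set
  Within _          nothing  = ⊤
  Within (lo , hi) (just c) = lo ≤ + c × + c + + 1 ≤ hi

  record Consistent (φ : Assignment n) (s : PState b G D) : Set where
    field
      within : ∀ v → Within (lookup φ v) (lookup s v)
      edges  : ∀ u v → E u v → EdgeOK b G D (proj₁ (lookup φ u)) (lookup s u) (lookup s v)

  first-position≤n : ∀ {c} → c ℕ.< numSeg n b → c ℕ.* suc b ℕ.+ 1 ℕ.≤ n
  first-position≤n {c} c<numSeg = ℕP.+-cancelʳ-≤ b _ _ (begin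
    c ℕ.* suc b ℕ.+ 1 ℕ.+ b      ≡⟨ regroup c b ⟩
    suc c ℕ.* suc b              ≤⟨ ℕP.*-monoˡ-≤ (suc b) c<numSeg ⟩
    numSeg n b ℕ.* suc b         ≤⟨ m/n*n≤m (n ℕ.+ b) (suc b) ⟩
    n ℕ.+ b                      ∎)
    where
    open ℕP.≤-Reasoning
    regroup : ∀ c b → c ℕ.* suc b ℕ.+ 1 ℕ.+ b ≡ suc c ℕ.* suc b
    regroup = solve-∀

  first-position-∈ : ∀ {c} → c ℕ.< numSeg n b → InSeg n b (baseSeg c) (c ℕ.* suc b ℕ.+ 1)
  first-position-∈ {c} c<numSeg =
    ℕP.m≤n+m 1 _ , first-position≤n c<numSeg ,
    ℤP.≤-reflexive (cong (_+ + 1) (sym (ℤP.pos-* c (suc b)))) ,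
    subst (+ (c ℕ.* suc b ℕ.+ 1) ≤_) (ℤP.pos-* (suc c) (suc b))
      (+≤+ (subst (c ℕ.* suc b ℕ.+ 1 ℕ.≤_) (ℕP.+-comm (c ℕ.* suc b) (suc b))
             (ℕP.+-monoʳ-≤ (c ℕ.* suc b) (s≤s z≤n))))

  -- Only the first position c (b+1) + 1 of Θ_c is needed to locate Θ_c inside φ(v).
  base-segment-within : ∀ ph c → InSeg n b ph (c ℕ.* suc b ℕ.+ 1) → Within ph (just c)
  base-segment-within (lo , hi) c (_ , _ , lo-bound , hi-bound) = lo≤c , c+1≤hi
    where
    p≡ : + (c ℕ.* suc b ℕ.+ 1) ≡ + c * + suc b + + 1
    p≡ = cong (_+ + 1) (ℤP.pos-* c (suc b))

    lo≤c : lo ≤ + c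
    lo≤c = ℤP.*-cancelʳ-≤-pos lo (+ c) (+ suc b) (+-cancelʳ-≤ (+ 1) (subst (lo * + suc b + + 1 ≤_) p≡ lo-bound))

    c+1≤hi : + c + + 1 ≤ hi
    c+1≤hi = subst (_≤ hi) (ℤP.+-comm (+ 1) (+ c)) (ℤP.i<j⇒suc[i]≤j {+ c} (ℤP.*-cancelʳ-<-nonNeg (+ suc b)
               (ℤP.suc[i]≤j⇒i<j (subst (_≤ hi * + suc b) (trans p≡ (ℤP.+-comm (+ c * + suc b) (+ 1))) hi-bound))))

  state-within : ∀ {φ s} → IsState b G D φ s → ∀ v → Within (lookup φ v) (lookup s v)
  state-within {φ} {s} st v with lookup s v in sv≡c
  ... | nothing = tt
  ... | just c  = base-segment-within (lookup φ v) c (subset v c sv≡c _ (first-position-∈ (range v c sv≡c)))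
    where open IsState st

  visited-consistent : ∀ {φ s} → Visited b G D φ s → Consistent φ s
  visited-consistent {φ} start = record
    { within = λ v → subst (Within (lookup φ v)) (sym (lookup-replicate v nothing)) tt
    ; edges  = λ u v _ → subst₂ (EdgeOK b G D _) (sym (lookup-replicate u nothing)) (sym (lookup-replicate v nothing)) tt
    }
  visited-consistent (move _ m) = record
    { within = state-within s'-state
    ; edges  = IsState.edges s'-state
    }
    where open Move m

  EO : ℤ → Maybe ℕ → Maybe ℕ → Set
  EO = EdgeOK b G D

  upper-index : ∀ lo a → Within (lo , lo + + 2) (just a) → + a ≢ lo → + a ≡ lo + + 1
  upper-index lo a (lo≤a , a+1≤lo+2) a≢lo with window₂ lo (+ a) lo≤a a+1≤lo+2
  ... | inj₁ a≡lo   = ⊥-elim (a≢lo a≡lo)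
  ... | inj₂ a≡lo+1 = a≡lo+1

  state-cong : ∀ {ph : ℤ × ℤ} {x y : ℤ} → x ≡ y → (ph , just x) ≡ (ph , just y)
  state-cong = cong (λ z → (_ , just z))

  inner-child-∈ : ∀ lo ma j mv → Within (lo , lo + + 2) ma → j ≡ lo - + 1 ⊎ j ≡ lo + + 1 →
                  Within (j , j + + 2) mv → EO lo ma mv → EO j mv ma →
                  innerItem j (Maybe.map +_ mv) ∈ innerCands (sitsLow ((lo , lo + + 2) , Maybe.map +_ ma)) lo
  inner-child-∈ lo nothing _ nothing  _ (inj₁ refl) _ _ _ = here refl
  inner-child-∈ lo nothing _ (just c) _ (inj₁ refl) (j≤c , c+1≤) lo≤c _ with window₂ (lo - + 1) (+ c) j≤c c+1≤
  ... | inj₁ c≡lo-1 = ⊥-elim (i≰i-1 lo (subst (lo ≤_) c≡lo-1 lo≤c))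
  ... | inj₂ c≡lo   = there (here (state-cong c≡lo))
  inner-child-∈ lo nothing _ nothing  _ (inj₂ refl) _ _ _ = there (there (here refl))
  inner-child-∈ lo nothing _ (just c) _ (inj₂ refl) (j≤c , c+1≤) _ _ with window₂ (lo + + 1) (+ c) j≤c c+1≤
  ... | inj₁ c≡lo+1 = there (there (there (here (state-cong c≡lo+1))))
  ... | inj₂ c≡lo+2 = there (there (there (there (here (state-cong c≡lo+2)))))
  inner-child-∈ lo (just a) j mv a-within side mv-within down up with + a ℤ.≟ lo
  inner-child-∈ lo (just a) _ nothing  _ (inj₁ refl) _ _ _ | yes a≡lo = here refl
  inner-child-∈ lo (just a) _ (just c) _ (inj₁ refl) (j≤c , c+1≤) _ _ | yes a≡lo with window₂ (lo - + 1) (+ c) j≤c c+1≤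
  ... | inj₁ c≡lo-1 = there (here (state-cong c≡lo-1))
  ... | inj₂ c≡lo   = there (there (here (state-cong c≡lo)))
  inner-child-∈ lo (just a) _ nothing  _ (inj₂ refl) _ _ lo+1≤a | yes a≡lo = ⊥-elim (i+1≰i lo (subst (lo + + 1 ≤_) a≡lo lo+1≤a))
  inner-child-∈ lo (just a) _ (just c) _ (inj₂ refl) (j≤c , c+1≤) (_ , c≤1+a) _ | yes a≡lo with window₂ (lo + + 1) (+ c) j≤c c+1≤
  ... | inj₁ c≡lo+1 = there (there (there (here (state-cong c≡lo+1))))
  ... | inj₂ c≡lo+2 = ⊥-elim (i+1≰i (lo + + 1) (pos-≤-suc c≤1+a c≡lo+2 a≡lo))
  inner-child-∈ lo (just a) _ nothing  _ (inj₁ refl) _ _ _ | no a≢lo = here refl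
  inner-child-∈ lo (just a) _ (just c) a-within (inj₁ refl) (j≤c , c+1≤) (a≤1+c , _) _ | no a≢lo with window₂ (lo - + 1) (+ c) j≤c c+1≤
  ... | inj₁ c≡lo-1 = ⊥-elim (i+1≰i-1+1 lo (pos-≤-suc a≤1+c (upper-index lo a a-within a≢lo) c≡lo-1))
  ... | inj₂ c≡lo   = there (here (state-cong c≡lo))
  inner-child-∈ lo (just a) _ nothing  _ (inj₂ refl) _ _ _ | no a≢lo = there (there (here refl))
  inner-child-∈ lo (just a) _ (just c) _ (inj₂ refl) (j≤c , c+1≤) _ _ | no a≢lo with window₂ (lo + + 1) (+ c) j≤c c+1≤
  ... | inj₁ c≡lo+1 = there (there (there (here (state-cong c≡lo+1))))
  ... | inj₂ c≡lo+2 = there (there (there (there (here (state-cong c≡lo+2)))))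

  leaf-state-∈ : ∀ lo ma mv → Within (lo , lo + + 2) ma → Within (lo - + 1 , lo + + 3) mv → EO lo ma mv →
                 Maybe.map +_ mv ∈ leafStates (sitsLow ((lo , lo + + 2) , Maybe.map +_ ma)) lo
  leaf-state-∈ lo nothing nothing  _ _ _ = here refl
  leaf-state-∈ lo nothing (just c) _ (lo-1≤c , c+1≤) lo≤c with window₄ lo (+ c) lo-1≤c c+1≤
  ... | inj₁ c≡lo-1                = ⊥-elim (i≰i-1 lo (subst (lo ≤_) c≡lo-1 lo≤c))
  ... | inj₂ (inj₁ c≡lo)           = there (here (cong just c≡lo))
  ... | inj₂ (inj₂ (inj₁ c≡lo+1))  = there (there (here (cong just c≡lo+1)))
  ... | inj₂ (inj₂ (inj₂ c≡lo+2))  = there (there (there (here (cong just c≡lo+2))))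
  leaf-state-∈ lo (just a) mv a-within mv-within down with + a ℤ.≟ lo
  leaf-state-∈ lo (just a) nothing  _ _ _ | yes a≡lo = here refl
  leaf-state-∈ lo (just a) (just c) _ (lo-1≤c , c+1≤) (_ , c≤1+a) | yes a≡lo with window₄ lo (+ c) lo-1≤c c+1≤
  ... | inj₁ c≡lo-1                = there (here (cong just c≡lo-1))
  ... | inj₂ (inj₁ c≡lo)           = there (there (here (cong just c≡lo)))
  ... | inj₂ (inj₂ (inj₁ c≡lo+1))  = there (there (there (here (cong just c≡lo+1))))
  ... | inj₂ (inj₂ (inj₂ c≡lo+2))  = ⊥-elim (i+2≰i+1 lo (pos-≤-suc c≤1+a c≡lo+2 a≡lo))
  leaf-state-∈ lo (just a) nothing  _ _ _ | no a≢lo = here refl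
  leaf-state-∈ lo (just a) (just c) a-within (lo-1≤c , c+1≤) (a≤1+c , _) | no a≢lo with window₄ lo (+ c) lo-1≤c c+1≤
  ... | inj₁ c≡lo-1                = ⊥-elim (i+1≰i-1+1 lo (pos-≤-suc a≤1+c (upper-index lo a a-within a≢lo) c≡lo-1))
  ... | inj₂ (inj₁ c≡lo)           = there (here (cong just c≡lo))
  ... | inj₂ (inj₂ (inj₁ c≡lo+1))  = there (there (here (cong just c≡lo+1)))
  ... | inj₂ (inj₂ (inj₂ c≡lo+2))  = there (there (there (here (cong just c≡lo+2))))

  rootLow-∈ : ∀ i → NonEmptySeg n b (i , i + + 2) → i ∈ rootLows n
  rootLow-∈ (+ k) (p , _ , p≤n , k-bound , _) = there (∈-applyUpTo⁺ +_ (begin-strict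
    k                     ≤⟨ ℕP.m≤m*n k (suc b) ⟩
    k ℕ.* suc b           <⟨ ℕP.m<m+n (k ℕ.* suc b) (s≤s z≤n) ⟩
    k ℕ.* suc b ℕ.+ 1     ≤⟨ ℤP.drop‿+≤+ (subst (_≤ + p) (cong (_+ + 1) (sym (ℤP.pos-* k (suc b)))) k-bound) ⟩
    p                     ≤⟨ p≤n ⟩
    n                     ∎))
    where open ℕP.≤-Reasoning
  rootLow-∈ -[1+ 0 ]     _                         = here refl
  rootLow-∈ -[1+ suc m ] (p , 1≤p , _ , _ , p≤hi) =
    ⊥-elim (ℕP.<-irrefl refl (ℕP.<-≤-trans 1≤p (ℤP.drop‿+≤+ (ℤP.≤-trans p≤hi hi≤0))))
    where
    hi≤0 : (-[1+ suc m ] + + 2) * + suc b ≤ + 0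
    hi≤0 = ℤP.*-monoʳ-≤-nonNeg (+ suc b) (ℤP.+-monoˡ-≤ (+ 2) { -[1+ suc m ]} { -[1+ 1 ]} (-≤- (s≤s z≤n)))

  root-item-∈ : ∀ {ph mv} i → ph ≡ (i , i + + 2) → i ∈ rootLows n → Within ph mv → (ph , Maybe.map +_ mv) ∈ rootCands n
  root-item-∈ {mv = nothing} i refl i∈ _ = ∈-concatMap⁺ rootItems (Any.map (λ { refl → here refl }) i∈)
  root-item-∈ {mv = just c}  i refl i∈ (i≤c , c+1≤) = ∈-concatMap⁺ rootItems (Any.map (λ { refl → c∈ }) i∈)
    where
    c∈ : innerItem i (just (+ c)) ∈ rootItems i
    c∈ with window₂ i (+ c) i≤c c+1≤
    ... | inj₁ c≡i   = there (here (state-cong c≡i))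
    ... | inj₂ c≡i+1 = there (there (here (state-cong c≡i+1)))

  leaf-item-∈ : ∀ {phu phv ma mv} lo → phu ≡ (lo , lo + + 2) → phv ≡ (lo - + 1 , lo + + 3) →
                Within phu ma → Within phv mv → EO (proj₁ phu) ma mv →
                (phv , Maybe.map +_ mv) ∈ leafCands (sitsLow (phu , Maybe.map +_ ma)) (proj₁ phu)
  leaf-item-∈ lo refl refl u-within v-within down = ∈-map⁺ _ (leaf-state-∈ lo _ _ u-within v-within down)

  inner-item-∈ : ∀ {phu phv ma mv} lo j → phu ≡ (lo , lo + + 2) → phv ≡ (j , j + + 2) → j ≡ lo - + 1 ⊎ j ≡ lo + + 1 →
                 Within phu ma → Within phv mv → EO (proj₁ phu) ma mv → EO (proj₁ phv) mv ma →
                 (phv , Maybe.map +_ mv) ∈ innerCands (sitsLow (phu , Maybe.map +_ ma)) (proj₁ phu)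
  inner-item-∈ lo j refl refl side u-within v-within down up = inner-child-∈ lo _ j _ u-within side v-within down up

  item : Assignment n → PState b G D → Fin n → Item
  item φ s v = (lookup φ v , Maybe.map +_ (lookup s v))

  items : Assignment n → PState b G D → Vec Item n
  items φ s = V.tabulate (item φ s)

  items-injective : ∀ {φ s φ′ s′} → items φ s ≡ items φ′ s′ → (φ , s) ≡ (φ′ , s′)
  items-injective {φ} {s} {φ′} {s′} eq =
    cong₂ _,_ (lookup-extensionality φ φ′ λ v → cong proj₁ (item≡ v))
              (lookup-extensionality s s′ λ v → map-pos-injective (cong proj₂ (item≡ v)))
    where
    item≡ : ∀ v → item φ s v ≡ item φ′ s′ v
    item≡ v = trans (sym (lookup∘tabulate (item φ s) v)) (trans (cong (λ xs → lookup xs v) eq) (lookup∘tabulate (item φ′ s′) v))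
    map-pos-injective : ∀ {m m′ : Maybe ℕ} → Maybe.map +_ m ≡ Maybe.map +_ m′ → m ≡ m′
    map-pos-injective {nothing} {nothing} _  = refl
    map-pos-injective {just _}  {just _}  eq = cong just (ℤP.+-injective (just-injective eq))

  module _ {φ s} (generated : Generated b G D φ) (consistent : Consistent φ s) where
    open Generated generated
    open Consistent consistent
    open RootedSpanningTree D
    open Weights D

    parent-not-leaf : ∀ {u v} → parent v ≡ just u → ¬ IsLeaf D u
    parent-not-leaf {u} {v} pv≡u u-leaf = proj₂ u-leaf v pv≡u

    child-∈ : ∀ {v u} → parent v ≡ just u → (leaf : Dec (IsLeaf D v)) → item φ s v ∈ childCandsFor leaf (item φ s u)
    child-∈ {v} {u} pv≡u leaf with inner u (parent-not-leaf pv≡u)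
    child-∈ {v} {u} pv≡u (yes v-leaf) | lo , φu≡ =
      leaf-item-∈ lo φu≡ (trans (Generated.leaf generated v u pv≡u v-leaf) (cong (λ k → k - + 1 , k + + 3) (cong proj₁ φu≡)))
        (within u) (within v) (edges u v (parent-edge pv≡u))
    child-∈ {v} {u} pv≡u (no v-inner) | lo , φu≡ with inner v v-inner
    ... | j , φv≡ = inner-item-∈ lo j φu≡ φv≡ side (within u) (within v) (edges u v (parent-edge pv≡u)) (edges v u (Graph.sym G (parent-edge pv≡u)))
      where
      side : j ≡ lo - + 1 ⊎ j ≡ lo + + 1
      side = Sum.map (λ e → trans (sym (cong proj₁ φv≡)) (trans e (cong (_- + 1) (cong proj₁ φu≡))))
                     (λ e → trans (sym (cong proj₁ φv≡)) (trans e (cong (_+ + 1) (cong proj₁ φu≡))))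
                     (inner-child v u pv≡u v-inner)

    items-admissible : Admissible (items φ s)
    items-admissible = record
      { root-admissible  = λ v pv≡nothing → subst (_∈ rootCands n) (sym (lookup∘tabulate (item φ s) v)) (root-∈ v pv≡nothing)
      ; child-admissible = λ v u pv≡u → subst₂ (λ x y → x ∈ childCands v y)
                             (sym (lookup∘tabulate (item φ s) v)) (sym (lookup∘tabulate (item φ s) u)) (child-∈ pv≡u (leaf? v))
      }
      where
      root-∈ : ∀ v → parent v ≡ nothing → item φ s v ∈ rootCands n
      root-∈ v pv≡nothing with v F.≟ root
      ... | no v≢root with () ← trans (sym pv≡nothing) (proj₂ (has-parent v v≢root))
      ... | yes refl with inner root (λ root-leaf → proj₁ root-leaf refl)
      ...   | i , φr≡ = root-item-∈ i φr≡ (rootLow-∈ i (subst (NonEmptySeg n b) φr≡ (nonempty root))) (within root)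

open import Data.Nat using (ℕ; suc; _≤_; _<_; _*_; _+_; _^_; z≤n; s≤s)
import Data.Nat.Properties as ℕP
open import Data.Nat.Tactic.RingSolver using (solve-∀)
open import Data.Product using (Σ; ∃; ∃-syntax; _×_; _,_; uncurry)
open import Data.List using (List; length; map)
import Data.List.Properties as LP
open import Data.List.Relation.Unary.All as All using (All)
open import Data.List.Relation.Unary.All.Properties using (map⁺)
open import Data.List.Relation.Unary.Unique.Propositional using (Unique)
import Data.List.Relation.Unary.Unique.Propositional.Properties as Unique
open import Relation.Binary.PropositionalEquality
open Candidates

visited-pairs-bound : (n b : ℕ) (G : Graph n) (D : RootedSpanningTree G) →
        (L : List (Assignment n × PState b G D)) → Unique L → All (GenVisited b G D) L →
        length L * 35 ^ n ≤ 3 * (n + 1) * 169 ^ n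
visited-pairs-bound n b G D L L! L-visited = begin
  length L * 35 ^ n                      ≡⟨ cong (_* 35 ^ n) (LP.length-map (uncurry items) L) ⟨
  length (map (uncurry items) L) * 35 ^ n
    ≤⟨ count-admissible rootBound childBound (map (uncurry items) L)
         (Unique.map⁺ items-injective L!)
         (map⁺ (All.map (λ { (generated , visited) → items-admissible generated (visited-consistent visited) }) L-visited)) ⟩
  potential unlabelled                   ≡⟨ ℕP.*-cancelʳ-≡ _ _ 169 (trans potential-unlabelled (regroup n (169 ^ n))) ⟩
  3 * (n + 1) * 169 ^ n                  ∎
  where
  open ℕP.≤-Reasoning
  open Consistency b D
  open Weights D
  regroup : ∀ n x → 3 * (n + 1) * 169 * x ≡ 3 * (n + 1) * x * 169
  regroup = solve-∀

lemma7 : ∃[ κn ] ∃[ κd ] ((1 ≤ κd) × (κn * 100 < 483 * κd) ×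
    ((n b : ℕ) → 2 ≤ n → 1 ≤ b → b < n →
    (G : Graph n) → Connected G → (D : RootedSpanningTree G) →
    (L : List (Assignment n × PState b G D)) → Unique L →
    All (GenVisited b G D) L →
    length L * κd ^ n ≤ 3 * (n + 1) * κn ^ n))
lemma7 = 169 , 35 , s≤s z≤n , ℕP.m≤m+n 16901 4 , λ n b _ _ _ G _ D L L! L-visited → visited-pairs-bound n b G D L L! L-visited
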